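{- For every integer $k\ge 2$ there exists a word $\gamma_k$ such that, for all $n\ge k$, $\gamma_k$ is a primitive generator of $\alpha^{(k)}_n$.
   Context: For $k\ge 2$, let $\sigma\colon\{1,\dots,k\}^*\to\{1,\dots,k\}^*$ be the monoid endomorphism with $\sigma(i)=1\cdot(i+1)$ (the two-letter word consisting of the letter $1$ followed by the letter $i+1$) for $i<k$, and $\sigma(k)=1$. Define $\alpha^{(k)}_1=1$ and $\alpha^{(k)}_{n+1}=\sigma(\alpha^{(k)}_n)$ for $n\ge 1$. For integers $i,k$, $[i,k]=\{j\in\mathbb{Z}: i\le j\le k\}$. For a word $u=a_1\cdots a_n$ and $f\colon[1,m]\to[1,n]$, $u^f=a_{f(1)}\cdots a_{f(m)}$. A walk is a surjection $f\colon[1,m]\to[1,n]$ with $|f(i+1)-f(i)|\le1$ for $1\le i<m$. A word $u$ generates $w$ if $w=u^f$ for some walk $f$; $u$ is primitive if it is not generated by any strictly shorter word; a primitive generator of $w$ is a primitive word that generates $w$. -}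

module Defs where

open import Data.Nat using (ℕ; zero; suc; _+_; _<_; _≤_)
open import Data.Fin using (Fin; toℕ)
open import Data.List using (List; []; _∷_; length; lookup; tabulate; concatMap)
open import Data.Product using (Σ; ∃; _×_; _,_)
open import Relation.Binary.PropositionalEquality using (_≡_)
open import Relation.Nullary using (¬_)

-- Words over the letters 1,…,k are lists of natural numbers (letters ≥ 1).
Word : Set
Word = List ℕ

-- The substitution σ = σ_k on single letters: σ(i) = 1 (i+1) for i < k, σ(k) = 1.
-- (Letters outside [1,k] never occur; for definiteness any i ≥ k is sent to 1.)
σ-letter : ℕ → ℕ → Word
σ-letter k i with suc i Data.Nat.≤? k
... | Relation.Nullary.yes _ = 1 ∷ suc i ∷ []
... | Relation.Nullary.no _  = 1 ∷ []

σ : ℕ → Word → Word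
σ k = concatMap (σ-letter k)

-- α^{(k)}_n, indexed from n = 1: α 1 = 1, α (n+1) = σ (α n).
-- (α k 0 is an unused junk value equal to α k 1.)
α : ℕ → ℕ → Word
α k zero = 1 ∷ []
α k (suc zero) = 1 ∷ []
α k (suc (suc n)) = σ k (α k (suc n))

Adjacent : ℕ → ℕ → Set
Adjacent x y = (x ≤ suc y) × (y ≤ suc x)

-- A walk [1,m] → [1,n] (0-indexed here as Fin m → Fin n): surjective,
-- with consecutive values differing by at most 1.
IsWalk : {m n : ℕ} → (Fin m → Fin n) → Set
IsWalk {m} {n} f =
  ((j : Fin n) → ∃ λ i → f i ≡ j) ×
  ((i : ℕ) (p : suc i < m) (q : i < m) →
     Adjacent (toℕ (f (Data.Fin.fromℕ< q))) (toℕ (f (Data.Fin.fromℕ< p))))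

_^_ : (u : Word) {m : ℕ} → (Fin m → Fin (length u)) → Word
(u ^ f) = tabulate (λ i → lookup u (f i))

Generates : Word → Word → Set
Generates u w = Σ (Fin (length w) → Fin (length u)) λ f → IsWalk f × (w ≡ u ^ f)

Primitive : Word → Set
Primitive u = (v : Word) → length v < length u → ¬ Generates v u

PrimitiveGenerator : Word → Word → Set
PrimitiveGenerator γ w = Primitive γ × Generates γ w

-- Take γ₂ = 12 and γ_{k+1} = raise γ_k, where raise (a₁ a₂ ⋯ aₘ) = (a₁+1) 1 (a₂+1) 1 ⋯ 1 (aₘ+1).
--
-- Generation: σ_k restricted to its letters ≤ m is σ_m, and if u generates the letters < m of x,
-- then raise u generates σ_m x: the old walk is doubled, and every 1 of σ_m x is read from a 1 of
-- raise u next to the current letter. Since 12 generates every word in 12{1,2}*, such as the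
-- restriction of α^{(k)}_n to the letters 1 and 2, induction on m shows that γ_k generates α^{(k)}_n.
--
-- Primitivity: if v generates raise w, the walk crosses every pair of neighbouring positions of v
-- at some step of raise w, and every such step reads a 1; so no two neighbouring letters of v
-- differ from 1. Deleting the 1s of v and decrementing the other letters therefore gives a word of
-- length ≤ (|v| + 1)/2 which generates w, whence |v| ≥ 2|w| − 1 = |raise w| by induction.

module Submission where

open import Defs
open import Data.Nat using (ℕ; zero; suc; pred; _+_; _≤_; _<_; z≤n; s≤s; _≟_; _≤?_; _<?_)
open import Data.Nat.Properties
  using ( module ≤-Reasoning; ≤-refl; ≤-trans; ≤-antisym; ≤-pred; <⇒≤; ≤∧≢⇒<; <-cmp; n≤1+n; n<1+n; <⇒≱
        ; suc-injective; pred-mono-≤)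
open import Data.Fin using (Fin; toℕ; fromℕ<) renaming (zero to fzero; suc to fsuc)
open import Data.Fin.Properties using (toℕ-fromℕ<; toℕ-injective; toℕ<n)
open import Data.List using (List; []; _∷_; head; length; map; filter; take; tabulate; lookup)
open import Data.List.Properties
  using ( ∷-injective; ∷-injectiveˡ; ∷-injectiveʳ; map-∘; map-id-local; length-map; map-tabulate; tabulate-cong
        ; filter-accept; filter-reject; filter-all)
open import Data.List.Membership.Propositional using (_∈_)
open import Data.List.Membership.Propositional.Properties using (∈-map⁺)
open import Data.List.Relation.Unary.Any using (here; there)
open import Data.List.Relation.Unary.All using (All; []; _∷_)
import Data.List.Relation.Unary.All as All
import Data.List.Relation.Unary.All.Properties as All
import Data.List.Relation.Unary.Any.Properties as Any
open import Data.List.Relation.Unary.Linked using (Linked; []; [-]; _∷_; _∷′_)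
import Data.List.Relation.Unary.Linked as Linked
import Data.List.Relation.Unary.Linked.Properties as Linked
open import Data.Maybe.Relation.Binary.Connected using (Connected; just; just-nothing)
open import Data.Maybe using (just)
open import Data.Product using (Σ; ∃; _×_; _,_; proj₁; proj₂)
open import Data.Sum using (_⊎_; inj₁; inj₂; [_,_]′; swap)
open import Data.Empty using (⊥-elim)
open import Relation.Nullary using (yes; no)
open import Relation.Binary.Definitions using (tri<; tri≈; tri>)
open import Relation.Binary.PropositionalEquality
open import Function using (id; _∘′_; _on_)

-- Out-of-range positions read as the junk letter 0.
at : Word → ℕ → ℕ
at []      _       = 0
at (a ∷ w) zero    = a
at (a ∷ w) (suc i) = at w i

-- A walk f : [1,m] → [1,n] recorded as the list of its (0-based) values.
record Walk (u w : Word) : Set where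
  constructor walk
  field
    path    : List ℕ
    steps   : Linked Adjacent path
    inRange : All (_< length u) path
    spells  : map (at u) path ≡ w
    onto    : ∀ q → q < length u → q ∈ path

lookup≡at : ∀ u (i : Fin (length u)) → lookup u i ≡ at u (toℕ i)
lookup≡at (a ∷ u) fzero    = refl
lookup≡at (a ∷ u) (fsuc i) = lookup≡at u i

All-at : ∀ {P : ℕ → Set} {ps} → All P ps → ∀ i → i < length ps → P (at ps i)
All-at (px ∷ pxs) zero    _       = px
All-at (px ∷ pxs) (suc i) (s≤s l) = All-at pxs i l

at-map : ∀ (f : ℕ → ℕ) ps i → i < length ps → at (map f ps) i ≡ f (at ps i)
at-map f (p ∷ ps) zero    _       = refl
at-map f (p ∷ ps) (suc i) (s≤s l) = at-map f ps i l

Linked-at : ∀ {R : ℕ → ℕ → Set} {ps} → Linked R ps → ∀ i → suc i < length ps → R (at ps i) (at ps (suc i))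
Linked-at [-]      zero    (s≤s ())
Linked-at (r ∷ _)  zero    _       = r
Linked-at (_ ∷ rs) (suc i) (s≤s l) = Linked-at rs i l

at-Linked : ∀ {R : ℕ → ℕ → Set} ps → (∀ i → suc i < length ps → R (at ps i) (at ps (suc i))) → Linked R ps
at-Linked []           _ = []
at-Linked (p ∷ [])     _ = [-]
at-Linked (p ∷ q ∷ ps) r = r 0 (s≤s (s≤s z≤n)) ∷ at-Linked (q ∷ ps) (λ i l → r (suc i) (s≤s l))

∈⇒at : ∀ {x ps} → x ∈ ps → ∃ λ i → i < length ps × at ps i ≡ x
∈⇒at (here refl) = 0 , s≤s z≤n , refl
∈⇒at (there x∈) with ∈⇒at x∈
... | i , l , e = suc i , s≤s l , e

≡tabulate : ∀ xs (g : Fin (length xs) → ℕ) → (∀ i → g i ≡ at xs (toℕ i)) → xs ≡ tabulate g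
≡tabulate []       g e = refl
≡tabulate (x ∷ xs) g e = cong₂ _∷_ (sym (e fzero)) (≡tabulate xs (λ i → g (fsuc i)) (λ i → e (fsuc i)))

Linked-tabulate : ∀ {R : ℕ → ℕ → Set} n (g : Fin n → ℕ) →
  (∀ i (p : suc i < n) (q : i < n) → R (g (fromℕ< q)) (g (fromℕ< p))) → Linked R (tabulate g)
Linked-tabulate zero                g r = []
Linked-tabulate (suc zero)          g r = [-]
Linked-tabulate (suc n@(suc _)) g r =
  r 0 (s≤s (s≤s z≤n)) (s≤s z≤n) ∷ Linked-tabulate n (λ i → g (fsuc i)) (λ i p q → r (suc i) (s≤s p) (s≤s q))

generates⇒walk : ∀ {u w} → Generates u w → Walk u w
generates⇒walk {u} {w} (f , (surjective , adjacent) , w≡u^f) =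
  walk ps (Linked-tabulate _ _ adjacent) (All.tabulate⁺ (λ i → toℕ<n (f i))) spells onto
  where
  ps = tabulate (λ i → toℕ (f i))
  spells : map (at u) ps ≡ w
  spells = begin
    map (at u) ps                          ≡⟨ map-tabulate _ (at u) ⟩
    tabulate (λ i → at u (toℕ (f i)))      ≡⟨ tabulate-cong (λ i → sym (lookup≡at u (f i))) ⟩
    u ^ f                                  ≡⟨ sym w≡u^f ⟩
    w                                      ∎
    where open ≡-Reasoning
  onto : ∀ q → q < length u → q ∈ ps
  onto q q<u with surjective (fromℕ< q<u)
  ... | i , fi≡q = Any.tabulate⁺ i (trans (sym (toℕ-fromℕ< q<u)) (cong toℕ (sym fi≡q)))

walk⇒generates : ∀ {u w} → Walk u w → Generates u w
walk⇒generates {u} (walk ps steps inRange refl onto) = f , (surjective , adjacent) , spells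
  where
  w = map (at u) ps
  |w|≡|ps| = length-map (at u) ps
  i<|ps| : (i : Fin (length w)) → toℕ i < length ps
  i<|ps| i = subst (toℕ i <_) |w|≡|ps| (toℕ<n i)
  f : Fin (length w) → Fin (length u)
  f i = fromℕ< (All-at inRange (toℕ i) (i<|ps| i))
  toℕ-f : ∀ i → toℕ (f i) ≡ at ps (toℕ i)
  toℕ-f i = toℕ-fromℕ< (All-at inRange (toℕ i) (i<|ps| i))
  spells : w ≡ u ^ f
  spells = ≡tabulate w _ λ i → begin
    lookup u (f i)         ≡⟨ lookup≡at u (f i) ⟩
    at u (toℕ (f i))       ≡⟨ cong (at u) (toℕ-f i) ⟩
    at u (at ps (toℕ i))   ≡⟨ sym (at-map (at u) ps (toℕ i) (i<|ps| i)) ⟩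
    at w (toℕ i)           ∎
    where open ≡-Reasoning
  surjective : ∀ j → ∃ λ i → f i ≡ j
  surjective j with ∈⇒at (onto (toℕ j) (toℕ<n j))
  ... | n , n<|ps| , ps[n]≡j = fromℕ< n<|w| , toℕ-injective (begin
    toℕ (f (fromℕ< n<|w|))       ≡⟨ toℕ-f (fromℕ< n<|w|) ⟩
    at ps (toℕ (fromℕ< n<|w|))   ≡⟨ cong (at ps) (toℕ-fromℕ< n<|w|) ⟩
    at ps n                      ≡⟨ ps[n]≡j ⟩
    toℕ j                        ∎)
    where
    open ≡-Reasoning
    n<|w| = subst (n <_) (sym |w|≡|ps|) n<|ps|
  adjacent : ∀ i (p : suc i < length w) (q : i < length w) →
    Adjacent (toℕ (f (fromℕ< q))) (toℕ (f (fromℕ< p)))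
  adjacent i p q rewrite toℕ-f (fromℕ< q) | toℕ-f (fromℕ< p) | toℕ-fromℕ< q | toℕ-fromℕ< p =
    Linked-at steps i (subst (suc i <_) |w|≡|ps| p)

Adjacent-refl : ∀ x → Adjacent x x
Adjacent-refl x = n≤1+n x , n≤1+n x

Adjacent-suc : ∀ x → Adjacent x (suc x)
Adjacent-suc x = ≤-trans (n≤1+n x) (n≤1+n (suc x)) , ≤-refl

Adjacent-sym : ∀ {x y} → Adjacent x y → Adjacent y x
Adjacent-sym (x≤1+y , y≤1+x) = y≤1+x , x≤1+y

Adjacent-≢ : ∀ {x y} → Adjacent x y → x ≢ y → y ≡ suc x ⊎ x ≡ suc y
Adjacent-≢ {x} {y} (x≤1+y , y≤1+x) x≢y with <-cmp x y
... | tri< x<y _ _ = inj₁ (≤-antisym y≤1+x x<y)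
... | tri≈ _ x≡y _ = ⊥-elim (x≢y x≡y)
... | tri> _ _ y<x = inj₂ (≤-antisym x≤1+y y<x)

∈-between : ∀ {ps a b m} → Linked Adjacent ps → a ∈ ps → b ∈ ps → a ≤ m → m ≤ b → m ∈ ps
∈-between {h ∷ _} {m = m} _ _ _ _ _ with h ≟ m
... | yes refl = here refl
∈-between _                (here refl) (here refl) a≤m m≤b | no h≢m = ⊥-elim (h≢m (≤-antisym a≤m m≤b))
∈-between ((_ , h′≤1+h) ∷ steps) (here refl) (there b∈) a≤m m≤b | no h≢m =
  there (∈-between steps (here refl) b∈ (≤-trans h′≤1+h (≤∧≢⇒< a≤m h≢m)) m≤b)
∈-between ((h≤1+h′ , _) ∷ steps) (there a∈) (here refl) a≤m m≤b | no h≢m =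
  there (∈-between steps a∈ (here refl) a≤m (≤-pred (≤-trans (≤∧≢⇒< m≤b (h≢m ∘′ sym)) h≤1+h′)))
∈-between steps (there a∈) (there b∈) a≤m m≤b | no _ = there (∈-between (Linked.tail steps) a∈ b∈ a≤m m≤b)

steps-across : ∀ {S : ℕ → ℕ → Set} {ps q} → Linked Adjacent ps → Linked S ps → q ∈ ps → suc q ∈ ps →
  S q (suc q) ⊎ S (suc q) q
steps-across _ _ (here refl) (here ())
steps-across {ps = _ ∷ h′ ∷ _} {q} ((_ , h′≤1+q) ∷ steps) (s ∷ ss) (here refl) (there 1+q∈) with h′ ≟ suc q
... | yes refl = inj₁ s
... | no h′≢1+q = steps-across steps ss
  (∈-between steps (here refl) 1+q∈ (≤-pred (≤∧≢⇒< h′≤1+q h′≢1+q)) (n≤1+n q)) 1+q∈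
steps-across {ps = _ ∷ h′ ∷ _} {q} ((1+q≤1+h′ , _) ∷ steps) (s ∷ ss) (there q∈) (here refl) with h′ ≟ q
... | yes refl = inj₂ s
... | no h′≢q = steps-across steps ss q∈
  (∈-between steps q∈ (here refl) (n≤1+n q) (≤∧≢⇒< (≤-pred 1+q≤1+h′) (h′≢q ∘′ sym)))
steps-across (_ ∷ steps) (_ ∷ ss) (there q∈) (there 1+q∈) = steps-across steps ss q∈ 1+q∈

double : ℕ → ℕ
double zero    = zero
double (suc n) = suc (suc (double n))

double-mono-≤ : ∀ {m n} → m ≤ n → double m ≤ double n
double-mono-≤ z≤n     = z≤n
double-mono-≤ (s≤s l) = s≤s (s≤s (double-mono-≤ l))

raise : Word → Word
raise []          = []
raise (a ∷ [])    = suc a ∷ []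
raise (a ∷ b ∷ w) = suc a ∷ 1 ∷ raise (b ∷ w)

suc-length-raise : ∀ a w → suc (length (raise (a ∷ w))) ≡ double (length (a ∷ w))
suc-length-raise a []      = refl
suc-length-raise a (b ∷ w) = cong (λ n → suc (suc n)) (suc-length-raise b w)

at-raise-double : ∀ u p → p < length u → at (raise u) (double p) ≡ suc (at u p)
at-raise-double (a ∷ [])    zero    _       = refl
at-raise-double (a ∷ [])    (suc p) (s≤s ())
at-raise-double (a ∷ b ∷ u) zero    _       = refl
at-raise-double (a ∷ b ∷ u) (suc p) (s≤s l) = at-raise-double (b ∷ u) p l

at-raise-odd : ∀ u e → suc e < length u → at (raise u) (suc (double e)) ≡ 1
at-raise-odd (a ∷ [])    zero    (s≤s ())
at-raise-odd (a ∷ b ∷ u) zero    _       = refl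
at-raise-odd (a ∷ b ∷ u) (suc e) (s≤s l) = at-raise-odd (b ∷ u) e l

HasOne : ℕ → ℕ → Set
HasOne x y = x ≡ 1 ⊎ y ≡ 1

raise-HasOne : ∀ w → Linked HasOne (raise w)
raise-HasOne []              = []
raise-HasOne (a ∷ [])        = [-]
raise-HasOne (a ∷ b ∷ [])    = inj₂ refl ∷ inj₁ refl ∷ [-]
raise-HasOne (a ∷ b ∷ c ∷ w) = inj₂ refl ∷ inj₁ refl ∷ raise-HasOne (b ∷ c ∷ w)

walk-raise-HasOne : ∀ {v w} → Walk v (raise w) → Linked HasOne v
walk-raise-HasOne {v} {w} (walk ps steps _ spells onto) = at-Linked v λ q 1+q<v →
  [ id , swap ]′ (steps-across steps images (onto q (<⇒≤ 1+q<v)) (onto (suc q) 1+q<v))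
  where
  images : Linked (HasOne on at v) ps
  images = Linked.map⁻ (subst (Linked HasOne) (sym spells) (raise-HasOne w))

lower : Word → Word
lower []                = []
lower (zero ∷ v)        = zero ∷ lower v
lower (suc zero ∷ v)    = lower v
lower (suc (suc a) ∷ v) = suc a ∷ lower v

-- The position in lower v of the letter at position q of v (if that letter is not 1).
rank : Word → ℕ → ℕ
rank v q = length (lower (take q v))

at-lower-rank : ∀ v p → at v p ≢ 1 → at (lower v) (rank v p) ≡ pred (at v p)
at-lower-rank []                p       _  = refl
at-lower-rank (zero ∷ v)        zero    _  = refl
at-lower-rank (suc zero ∷ v)    zero    ≢1 = ⊥-elim (≢1 refl)
at-lower-rank (suc (suc a) ∷ v) zero    _  = refl
at-lower-rank (zero ∷ v)        (suc p) ≢1 = at-lower-rank v p ≢1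
at-lower-rank (suc zero ∷ v)    (suc p) ≢1 = at-lower-rank v p ≢1
at-lower-rank (suc (suc a) ∷ v) (suc p) ≢1 = at-lower-rank v p ≢1

rank<length-lower : ∀ v p → p < length v → at v p ≢ 1 → rank v p < length (lower v)
rank<length-lower (zero ∷ v)        zero    _       _  = s≤s z≤n
rank<length-lower (suc zero ∷ v)    zero    _       ≢1 = ⊥-elim (≢1 refl)
rank<length-lower (suc (suc a) ∷ v) zero    _       _  = s≤s z≤n
rank<length-lower (zero ∷ v)        (suc p) (s≤s l) ≢1 = s≤s (rank<length-lower v p l ≢1)
rank<length-lower (suc zero ∷ v)    (suc p) (s≤s l) ≢1 = rank<length-lower v p l ≢1
rank<length-lower (suc (suc a) ∷ v) (suc p) (s≤s l) ≢1 = s≤s (rank<length-lower v p l ≢1)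

rank-surjective : ∀ v s → s < length (lower v) → ∃ λ p → p < length v × at v p ≢ 1 × rank v p ≡ s
rank-surjective (zero ∷ v)        zero    _ = 0 , s≤s z≤n , (λ ()) , refl
rank-surjective (suc (suc a) ∷ v) zero    _ = 0 , s≤s z≤n , (λ ()) , refl
rank-surjective (suc zero ∷ v)    s       l with rank-surjective v s l
... | p , p<v , ≢1 , refl = suc p , s≤s p<v , ≢1 , refl
rank-surjective (zero ∷ v)        (suc s) (s≤s l) with rank-surjective v s l
... | p , p<v , ≢1 , refl = suc p , s≤s p<v , ≢1 , refl
rank-surjective (suc (suc a) ∷ v) (suc s) (s≤s l) with rank-surjective v s l
... | p , p<v , ≢1 , refl = suc p , s≤s p<v , ≢1 , refl

rank-suc-one : ∀ v q → at v q ≡ 1 → rank v (suc q) ≡ rank v q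
rank-suc-one (suc zero ∷ v)    zero    _  = refl
rank-suc-one (zero ∷ v)        (suc q) ≡1 = cong suc (rank-suc-one v q ≡1)
rank-suc-one (suc zero ∷ v)    (suc q) ≡1 = rank-suc-one v q ≡1
rank-suc-one (suc (suc a) ∷ v) (suc q) ≡1 = cong suc (rank-suc-one v q ≡1)

rank-suc : ∀ v q → q < length v → at v q ≢ 1 → rank v (suc q) ≡ suc (rank v q)
rank-suc (zero ∷ v)        zero    _       _  = refl
rank-suc (suc zero ∷ v)    zero    _       ≢1 = ⊥-elim (≢1 refl)
rank-suc (suc (suc a) ∷ v) zero    _       _  = refl
rank-suc (zero ∷ v)        (suc q) (s≤s l) ≢1 = cong suc (rank-suc v q l ≢1)
rank-suc (suc zero ∷ v)    (suc q) (s≤s l) ≢1 = rank-suc v q l ≢1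
rank-suc (suc (suc a) ∷ v) (suc q) (s≤s l) ≢1 = cong suc (rank-suc v q l ≢1)

double-length-lower : ∀ {v} → Linked HasOne v → double (length (lower v)) ≤ suc (length v)
double-length-lower {[]}                _ = z≤n
double-length-lower {suc zero ∷ v}      h = ≤-trans (double-length-lower (Linked.tail h)) (n≤1+n _)
double-length-lower {zero ∷ []}         _ = ≤-refl
double-length-lower {suc (suc a) ∷ []}  _ = ≤-refl
double-length-lower {zero ∷ _ ∷ v}         (inj₂ refl ∷ h) = s≤s (s≤s (double-length-lower (Linked.tail h)))
double-length-lower {suc (suc a) ∷ _ ∷ v}  (inj₂ refl ∷ h) = s≤s (s≤s (double-length-lower (Linked.tail h)))

rank-Adjacent : ∀ v {p r p′} → p < length v → p′ < length v →
  at v p ≢ 1 → at v r ≡ 1 → at v p′ ≢ 1 → Adjacent p r → Adjacent r p′ → Adjacent (rank v p) (rank v p′)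
rank-Adjacent v {p} {r} {p′} p<v p′<v p≢1 r≡1 p′≢1 p~r r~p′
  with Adjacent-≢ p~r (λ p≡r → p≢1 (trans (cong (at v) p≡r) r≡1))
     | Adjacent-≢ r~p′ (λ r≡p′ → p′≢1 (trans (cong (at v) (sym r≡p′)) r≡1))
... | inj₁ refl | inj₁ refl rewrite rank-suc-one v (suc p) r≡1 | rank-suc v p p<v p≢1 = Adjacent-suc (rank v p)
... | inj₁ refl | inj₂ refl = Adjacent-refl (rank v p)
... | inj₂ refl | inj₁ refl = Adjacent-refl (rank v p)
... | inj₂ refl | inj₂ refl rewrite rank-suc-one v (suc p′) r≡1 | rank-suc v p′ p′<v p′≢1 =
  Adjacent-sym (Adjacent-suc (rank v p′))

-- Raised v ps w: the path ps spells raise w in v, for w nonempty and free of the letter 0.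
data Raised (v : Word) : List ℕ → Word → Set where
  [_]  : ∀ {p a} → at v p ≡ suc a × a ≢ 0 → Raised v (p ∷ []) (a ∷ [])
  step : ∀ {p r ps a b w} → at v p ≡ suc a × a ≢ 0 → at v r ≡ 1 →
         Raised v ps (b ∷ w) → Raised v (p ∷ r ∷ ps) (a ∷ b ∷ w)

raised : ∀ {v} ps a w → All (_≢ 0) (a ∷ w) → map (at v) ps ≡ raise (a ∷ w) → Raised v ps (a ∷ w)
raised (p ∷ [])         a []      (a≢0 ∷ _)   eq = [ ∷-injectiveˡ eq , a≢0 ]
raised (p ∷ r ∷ ps)     a (b ∷ w) (a≢0 ∷ nz) eq with ∷-injective eq
... | p↦ , r∷ps↦ = step (p↦ , a≢0) (∷-injectiveˡ r∷ps↦) (raised ps b w nz (∷-injectiveʳ r∷ps↦))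
raised []               a []      _ ()
raised (p ∷ _ ∷ _)      a []      _ ()
raised []               a (b ∷ w) _ ()
raised (p ∷ [])         a (b ∷ w) _ ()

≢1 : ∀ {x a} → x ≡ suc a × a ≢ 0 → x ≢ 1
≢1 (refl , a≢0) x≡1 = a≢0 (suc-injective x≡1)

at-lower-rank-raised : ∀ v p {a} → at v p ≡ suc a × a ≢ 0 → at (lower v) (rank v p) ≡ a
at-lower-rank-raised v p p↦ = trans (at-lower-rank v p (≢1 p↦)) (cong pred (proj₁ p↦))

evens : List ℕ → List ℕ
evens []           = []
evens (p ∷ [])     = p ∷ []
evens (p ∷ _ ∷ ps) = p ∷ evens ps

module _ {v : Word} where

  evens-spell : ∀ {ps w} → Raised v ps w → map (at (lower v) ∘′ rank v) (evens ps) ≡ w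
  evens-spell {p ∷ _} [ p↦ ]           = cong (_∷ []) (at-lower-rank-raised v p p↦)
  evens-spell {p ∷ _} (step p↦ _ rest) = cong₂ _∷_ (at-lower-rank-raised v p p↦) (evens-spell rest)

  evens-inRange : ∀ {ps w} → Raised v ps w → All (_< length v) ps →
    All (_< length (lower v)) (map (rank v) (evens ps))
  evens-inRange {p ∷ _} [ p↦ ]           (p<v ∷ _)      = rank<length-lower v p p<v (≢1 p↦) ∷ []
  evens-inRange {p ∷ _} (step p↦ _ rest) (p<v ∷ _ ∷ ps<v) =
    rank<length-lower v p p<v (≢1 p↦) ∷ evens-inRange rest ps<v

  evens-steps : ∀ {ps w} → Raised v ps w → Linked Adjacent ps → All (_< length v) ps →
    Linked Adjacent (map (rank v) (evens ps))
  evens-steps [ _ ] _ _ = [-]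
  evens-steps (step p↦ r↦ [ p′↦ ]) (p~r ∷ r~p′ ∷ _) (p<v ∷ _ ∷ p′<v ∷ _) =
    rank-Adjacent v p<v p′<v (≢1 p↦) r↦ (≢1 p′↦) p~r r~p′ ∷ [-]
  evens-steps (step p↦ r↦ rest@(step p′↦ _ _)) (p~r ∷ r~p′ ∷ steps) (p<v ∷ _ ∷ ps<v@(p′<v ∷ _)) =
    rank-Adjacent v p<v p′<v (≢1 p↦) r↦ (≢1 p′↦) p~r r~p′ ∷ evens-steps rest steps ps<v

  evens-∈ : ∀ {ps w q} → Raised v ps w → q ∈ ps → at v q ≢ 1 → q ∈ evens ps
  evens-∈ [ _ ]          (here refl)         _   = here refl
  evens-∈ (step _ _ _)    (here refl)         _   = here refl
  evens-∈ (step _ r↦ _)   (there (here refl)) q≢1 = ⊥-elim (q≢1 r↦)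
  evens-∈ (step _ _ rest) (there (there q∈))  q≢1 = there (evens-∈ rest q∈ q≢1)

lower-walk : ∀ {v a w} → All (_≢ 0) (a ∷ w) → Walk v (raise (a ∷ w)) → Walk (lower v) (a ∷ w)
lower-walk {v} {a} {w} nz (walk ps steps inRange spells onto) =
  walk (map (rank v) (evens ps)) (evens-steps view steps inRange) (evens-inRange view inRange)
       (trans (sym (map-∘ (evens ps))) (evens-spell view)) onto′
  where
  view = raised ps a w nz spells
  onto′ : ∀ s → s < length (lower v) → s ∈ map (rank v) (evens ps)
  onto′ s s<lv with rank-surjective v s s<lv
  ... | p , p<v , p≢1 , refl = ∈-map⁺ (rank v) (evens-∈ view (onto p p<v) p≢1)

raise-minimal : ∀ {w} → All (_≢ 0) w → (∀ {v} → Walk v w → length w ≤ length v) →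
  ∀ {v} → Walk v (raise w) → length (raise w) ≤ length v
raise-minimal {[]}    _  _       _ = z≤n
raise-minimal {a ∷ w} nz minimal {v} W = ≤-pred (begin
  suc (length (raise (a ∷ w)))  ≡⟨ suc-length-raise a w ⟩
  double (length (a ∷ w))       ≤⟨ double-mono-≤ (minimal (lower-walk nz W)) ⟩
  double (length (lower v))     ≤⟨ double-length-lower (walk-raise-HasOne W) ⟩
  suc (length v)                ∎)
  where open ≤-Reasoning

two-letters-minimal : ∀ {v} → Walk v (1 ∷ 2 ∷ []) → 2 ≤ length v
two-letters-minimal {_ ∷ _ ∷ _} _                                  = s≤s (s≤s z≤n)
two-letters-minimal {[]}        (walk (_ ∷ _) _ (() ∷ _) _ _)
two-letters-minimal {_ ∷ []}    (walk (zero ∷ zero ∷ []) _ _ () _)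
two-letters-minimal {_ ∷ []}    (walk (suc _ ∷ _) _ (s≤s () ∷ _) _ _)
two-letters-minimal {_ ∷ []}    (walk (_ ∷ suc _ ∷ _) _ (_ ∷ s≤s () ∷ _) _ _)

-- γ t is the generator for k = t + 2: 12, 213, 31214, …
γ : ℕ → Word
γ zero    = 1 ∷ 2 ∷ []
γ (suc t) = raise (γ t)

raise-nonzero : ∀ w → All (_≢ 0) (raise w)
raise-nonzero []          = []
raise-nonzero (a ∷ [])    = (λ ()) ∷ []
raise-nonzero (a ∷ b ∷ w) = (λ ()) ∷ (λ ()) ∷ raise-nonzero (b ∷ w)

γ-nonzero : ∀ t → All (_≢ 0) (γ t)
γ-nonzero zero    = (λ ()) ∷ (λ ()) ∷ []
γ-nonzero (suc t) = raise-nonzero (γ t)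

γ-minimal : ∀ t {v} → Walk v (γ t) → length (γ t) ≤ length v
γ-minimal zero    = two-letters-minimal
γ-minimal (suc t) = raise-minimal (γ-nonzero t) (γ-minimal t)

-- In raise u the 1 at position 2e + 1 sits between the letters from positions e and e + 1 of u,
-- so it is adjacent to the letter from position p (now at 2p) exactly when Near e p.
Near : ℕ → ℕ → Set
Near e p = e ≡ p ⊎ suc e ≡ p

Near⇒Adjacent : ∀ {e p} → Near e p → Adjacent (suc (double e)) (double p)
Near⇒Adjacent {e} (inj₁ refl) = Adjacent-sym (Adjacent-suc (double e))
Near⇒Adjacent {e} (inj₂ refl) = Adjacent-suc (suc (double e))

gapNear : ℕ → ℕ → ℕ
gapNear L p with suc p <? L
... | yes _ = p
... | no _  = pred p

gapNear-ok : ∀ {L p} → 2 ≤ L → p < L → suc (gapNear L p) < L × Near (gapNear L p) p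
gapNear-ok {L} {p} _ _ with suc p <? L
... | yes 2+p≤L = 2+p≤L , inj₁ refl
gapNear-ok {p = zero}  2≤L _   | no 2≰L = ⊥-elim (2≰L 2≤L)
gapNear-ok {p = suc p} _   p<L | no _   = p<L , inj₂ refl

gapBetween : ℕ → ℕ → List ℕ → ℕ
gapBetween L p []       = gapNear L p
gapBetween L p (p′ ∷ _) with <-cmp p p′
... | tri< _ _ _ = p
... | tri≈ _ _ _ = gapNear L p
... | tri> _ _ _ = p′

gapBetween-ok : ∀ {L p ps} → 2 ≤ L → p < L → All (_< L) ps → Linked Adjacent (p ∷ ps) →
  let e = gapBetween L p ps in suc e < L × Near e p × Connected Near (just e) (head ps)
gapBetween-ok {ps = []} 2≤L p<L _ _ with gapNear-ok 2≤L p<L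
... | gap<L , near = gap<L , near , just-nothing
gapBetween-ok {L} {p} {p′ ∷ _} 2≤L p<L (p′<L ∷ _) ((_ , p′≤1+p) ∷ _) with <-cmp p p′
... | tri< p<p′ _ _ = subst (_< L) (sym 1+p≡p′) p′<L , inj₁ refl , just (inj₂ 1+p≡p′)
  where 1+p≡p′ = ≤-antisym p<p′ p′≤1+p
... | tri≈ _ refl _ with gapNear-ok 2≤L p<L
...   | gap<L , near = gap<L , near , just near
gapBetween-ok {L} {p} {p′ ∷ _} 2≤L p<L (p′<L ∷ _) ((p≤1+p′ , _) ∷ _) | tri> _ _ p′<p =
  subst (_< L) (sym 1+p′≡p) p<L , inj₂ 1+p′≡p , just (inj₁ refl)
  where 1+p′≡p = ≤-antisym p′<p p≤1+p′

odd<length-raise : ∀ u {e} → suc e < length u → suc (double e) < length (raise u)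
odd<length-raise (a ∷ u) {e} 1+e<u = ≤-pred (begin
  suc (suc (suc (double e)))    <⟨ n<1+n _ ⟩
  double (suc (suc e))          ≤⟨ double-mono-≤ 1+e<u ⟩
  double (length (a ∷ u))       ≡⟨ sym (suc-length-raise a u) ⟩
  suc (length (raise (a ∷ u)))  ∎)
  where open ≤-Reasoning

double<length-raise : ∀ u {p} → p < length u → double p < length (raise u)
double<length-raise (a ∷ u) {p} p<u = ≤-pred (begin
  suc (suc (double p))          ≤⟨ double-mono-≤ p<u ⟩
  double (length (a ∷ u))       ≡⟨ sym (suc-length-raise a u) ⟩
  suc (length (raise (a ∷ u)))  ∎)
  where open ≤-Reasoning

module RaisePath (u : Word) (m : ℕ) (2≤u : 2 ≤ length u) where

  path : Word → List ℕ → ℕ → List ℕ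
  path []      ps e = []
  path (i ∷ x) ps e with suc i ≤? m
  path (i ∷ x) ps       e | no _  = suc (double e) ∷ path x ps e
  path (i ∷ x) []       e | yes _ = []
  path (i ∷ x) (p ∷ ps) e | yes _ = suc (double e) ∷ double p ∷ path x ps (gapBetween (length u) p ps)

  path-starts : ∀ x ps e {a} → Adjacent a (suc (double e)) → Connected Adjacent (just a) (head (path x ps e))
  path-starts []      ps       e a~e = just-nothing
  path-starts (i ∷ x) ps       e a~e with suc i ≤? m
  path-starts (i ∷ x) ps       e a~e | no _  = just a~e
  path-starts (i ∷ x) []       e a~e | yes _ = just-nothing
  path-starts (i ∷ x) (p ∷ ps) e a~e | yes _ = just a~e

  -- The state of the construction: the rest ps of the old walk, and the gap e whose 1 was read last.
  record Cursor (ps : List ℕ) (e : ℕ) : Set where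
    constructor cursor
    field
      steps   : Linked Adjacent ps
      inRange : All (_< length u) ps
      gap<u   : suc e < length u
      near    : Connected Near (just e) (head ps)

  advance : ∀ {p ps e} → Cursor (p ∷ ps) e → Cursor ps (gapBetween (length u) p ps)
  advance (cursor steps (p<u ∷ ps<u) _ _) with gapBetween-ok 2≤u p<u ps<u steps
  ... | gap<u , _ , near = cursor (Linked.tail steps) ps<u gap<u near

  near-next : ∀ {p ps e} → Cursor (p ∷ ps) e → Near (gapBetween (length u) p ps) p
  near-next (cursor steps (p<u ∷ ps<u) _ _) = proj₁ (proj₂ (gapBetween-ok 2≤u p<u ps<u steps))

  path-steps : ∀ x {ps e} → Cursor ps e → Linked Adjacent (path x ps e)
  path-steps []      c = []
  path-steps (i ∷ x) c with suc i ≤? m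
  path-steps (i ∷ x) {ps}     {e} c | no _  = path-starts x ps e (Adjacent-refl _) ∷′ path-steps x c
  path-steps (i ∷ x) {[]}         c | yes _ = []
  path-steps (i ∷ x) {p ∷ ps} {e} c@(cursor _ _ _ (just e~p)) | yes _ =
    Near⇒Adjacent e~p ∷ path-starts x ps _ (Adjacent-sym (Near⇒Adjacent (near-next c))) ∷′ path-steps x (advance c)

  path-inRange : ∀ x {ps e} → Cursor ps e → All (_< length (raise u)) (path x ps e)
  path-inRange []      c = []
  path-inRange (i ∷ x) c with suc i ≤? m
  path-inRange (i ∷ x) c | no _ = odd<length-raise u (Cursor.gap<u c) ∷ path-inRange x c
  path-inRange (i ∷ x) {[]} c | yes _ = []
  path-inRange (i ∷ x) {p ∷ ps} c@(cursor _ (p<u ∷ _) gap<u _) | yes _ =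
    odd<length-raise u gap<u ∷ double<length-raise u p<u ∷ path-inRange x (advance c)

  path-spells : ∀ x {ps e} → Cursor ps e → map (at u) ps ≡ filter (_<? m) x →
    map (at (raise u)) (path x ps e) ≡ σ m x
  path-spells []      c eq = refl
  path-spells (i ∷ x) c eq with suc i ≤? m
  path-spells (i ∷ x) c eq | no i≮m =
    cong₂ _∷_ (at-raise-odd u _ (Cursor.gap<u c)) (path-spells x c (trans eq (filter-reject (_<? m) i≮m)))
  path-spells (i ∷ x) {[]} c eq | yes i<m with () ← trans eq (filter-accept (_<? m) i<m)
  path-spells (i ∷ x) {p ∷ ps} c@(cursor _ (p<u ∷ _) gap<u _) eq | yes i<m
    with p↦i , ps↦x ← ∷-injective (trans eq (filter-accept (_<? m) i<m)) =
    cong₂ _∷_ (at-raise-odd u _ gap<u)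
      (cong₂ _∷_ (trans (at-raise-double u p p<u) (cong suc p↦i)) (path-spells x (advance c) ps↦x))

  path-∈ : ∀ x {ps e q} → map (at u) ps ≡ filter (_<? m) x → q ∈ ps → double q ∈ path x ps e
  path-∈ [] {[]} _ ()
  path-∈ (i ∷ x) eq q∈ with suc i ≤? m
  path-∈ (i ∷ x) eq q∈ | no i≮m = there (path-∈ x (trans eq (filter-reject (_<? m) i≮m)) q∈)
  path-∈ (i ∷ x) {[]} eq () | yes _
  path-∈ (i ∷ x) {p ∷ ps} eq (here refl) | yes _ = there (here refl)
  path-∈ (i ∷ x) {p ∷ ps} eq (there q∈) | yes i<m =
    there (there (path-∈ x (∷-injectiveʳ (trans eq (filter-accept (_<? m) i<m))) q∈))

raise-walk : ∀ {u x} m → 2 ≤ length u → Walk u (filter (_<? m) x) → Walk (raise u) (σ m x)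
raise-walk {_ ∷ _} m _ (walk [] _ _ _ onto) with () ← onto 0 (s≤s z≤n)
raise-walk {u@(a ∷ u′)} {x} m 2≤u (walk ps@(p ∷ _) steps inRange@(p<u ∷ _) spells onto) =
  walk (path x ps e₀) (path-steps x start) (path-inRange x start) (path-spells x start spells) onto′
  where
  open RaisePath u m 2≤u
  e₀ = gapNear (length u) p
  start : Cursor ps e₀
  start = cursor steps inRange (proj₁ (gapNear-ok 2≤u p<u)) (just (proj₂ (gapNear-ok 2≤u p<u)))
  |raise-u|≡ : length (raise u) ≡ suc (double (length u′))
  |raise-u|≡ = suc-injective (suc-length-raise a u′)
  -- The new walk visits 0 and the last position 2|u′|, hence everything in between.
  onto′ : ∀ q → q < length (raise u) → q ∈ path x ps e₀
  onto′ q q<ru = ∈-between (path-steps x start)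
    (path-∈ x spells (onto 0 (s≤s z≤n))) (path-∈ x spells (onto (length u′) ≤-refl))
    z≤n (≤-pred (subst (q <_) |raise-u|≡ q<ru))

filter-σ : ∀ {k m} → 1 ≤ m → m ≤ k → ∀ x → filter (_<? suc m) (σ k x) ≡ σ m x
filter-σ         _   _   []      = refl
filter-σ {k} {m} 1≤m m≤k (i ∷ x) with suc i ≤? k | suc i ≤? m
... | yes _   | yes i<m = begin
  filter (_<? suc m) (1 ∷ suc i ∷ σ k x)  ≡⟨ filter-accept (_<? suc m) (s≤s 1≤m) ⟩
  1 ∷ filter (_<? suc m) (suc i ∷ σ k x)  ≡⟨ cong (1 ∷_) (filter-accept (_<? suc m) (s≤s i<m)) ⟩
  1 ∷ suc i ∷ filter (_<? suc m) (σ k x)  ≡⟨ cong (λ w → 1 ∷ suc i ∷ w) (filter-σ 1≤m m≤k x) ⟩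
  1 ∷ suc i ∷ σ m x                       ∎
  where open ≡-Reasoning
... | yes _   | no i≮m  = begin
  filter (_<? suc m) (1 ∷ suc i ∷ σ k x)  ≡⟨ filter-accept (_<? suc m) (s≤s 1≤m) ⟩
  1 ∷ filter (_<? suc m) (suc i ∷ σ k x)  ≡⟨ cong (1 ∷_) (filter-reject (_<? suc m) (i≮m ∘′ ≤-pred)) ⟩
  1 ∷ filter (_<? suc m) (σ k x)          ≡⟨ cong (1 ∷_) (filter-σ 1≤m m≤k x) ⟩
  1 ∷ σ m x                               ∎
  where open ≡-Reasoning
... | no i≮k  | yes i<m = ⊥-elim (i≮k (≤-trans i<m m≤k))
... | no _    | no _    = trans (filter-accept (_<? suc m) (s≤s 1≤m)) (cong (1 ∷_) (filter-σ 1≤m m≤k x))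

Letter : ℕ → ℕ → Set
Letter k a = 1 ≤ a × a ≤ k

σ-letters : ∀ {k} → 1 ≤ k → ∀ x → All (Letter k) (σ k x)
σ-letters         _   []      = []
σ-letters {k} 1≤k (i ∷ x) with suc i ≤? k
... | yes i<k = (≤-refl , 1≤k) ∷ (s≤s z≤n , i<k) ∷ σ-letters 1≤k x
... | no _    = (≤-refl , 1≤k) ∷ σ-letters 1≤k x

α-letters : ∀ {k} → 1 ≤ k → ∀ n → All (Letter k) (α k n)
α-letters 1≤k zero          = (≤-refl , 1≤k) ∷ []
α-letters 1≤k (suc zero)    = (≤-refl , 1≤k) ∷ []
α-letters 1≤k (suc (suc n)) = σ-letters 1≤k (α _ (suc n))

α-starts-with-1 : ∀ k n → ∃ λ w → α (2 + k) (suc n) ≡ 1 ∷ w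
α-starts-with-1 k zero    = [] , refl
α-starts-with-1 k (suc n) with α-starts-with-1 k n
... | w , α≡1∷w = 2 ∷ σ (2 + k) w , cong (σ (2 + k)) α≡1∷w

α-starts-with-12 : ∀ k n → ∃ λ w → α (2 + k) (2 + n) ≡ 1 ∷ 2 ∷ w
α-starts-with-12 k n with α-starts-with-1 k n
... | w , α≡1∷w = σ (2 + k) w , cong (σ (2 + k)) α≡1∷w

≤1⇒Linked-Adjacent : ∀ {ps} → All (_≤ 1) ps → Linked Adjacent ps
≤1⇒Linked-Adjacent []                    = []
≤1⇒Linked-Adjacent (_ ∷ [])              = [-]
≤1⇒Linked-Adjacent (p≤1 ∷ ps≤1@(q≤1 ∷ _)) =
  (≤-trans p≤1 (s≤s z≤n) , ≤-trans q≤1 (s≤s z≤n)) ∷ ≤1⇒Linked-Adjacent ps≤1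

at-12-pred : ∀ {a} → Letter 2 a → at (1 ∷ 2 ∷ []) (pred a) ≡ a
at-12-pred {1} _ = refl
at-12-pred {2} _ = refl
at-12-pred {suc (suc (suc _))} (_ , s≤s (s≤s ()))

binary-walk : ∀ {y} → All (Letter 2) y → Walk (1 ∷ 2 ∷ []) (1 ∷ 2 ∷ y)
binary-walk {y} y∈12 = walk (0 ∷ 1 ∷ map pred y) (≤1⇒Linked-Adjacent ps≤1) (All.map s≤s ps≤1) spells onto
  where
  ps≤1 : All (_≤ 1) (0 ∷ 1 ∷ map pred y)
  ps≤1 = z≤n ∷ ≤-refl ∷ All.map⁺ (All.map (pred-mono-≤ ∘′ proj₂) y∈12)
  spells : map (at (1 ∷ 2 ∷ [])) (0 ∷ 1 ∷ map pred y) ≡ 1 ∷ 2 ∷ y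
  spells = cong (λ w → 1 ∷ 2 ∷ w) (trans (sym (map-∘ y)) (map-id-local (All.map at-12-pred y∈12)))
  onto : ∀ q → q < 2 → q ∈ 0 ∷ 1 ∷ map pred y
  onto 0 _ = here refl
  onto 1 _ = there (here refl)
  onto (suc (suc _)) (s≤s (s≤s ()))

γ-length : ∀ t → 2 ≤ length (γ t)
γ-length zero    = ≤-refl
γ-length (suc t) with γ t | γ-length t
... | _ ∷ _ ∷ _ | _       = s≤s (s≤s z≤n)
... | _ ∷ []    | s≤s ()

γ-walk : ∀ t {k n} → 2 + t ≤ k → 2 + t ≤ n → Walk (γ t) (filter (_<? 3 + t) (α k n))
γ-walk zero {suc (suc k)} {suc (suc n)} (s≤s (s≤s _)) (s≤s (s≤s _))
  with α (2 + k) (2 + n) | α-starts-with-12 k n | α-letters {2 + k} (s≤s z≤n) (2 + n)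
... | _ | w , refl | _ ∷ _ ∷ w-letters =
  binary-walk (All.zipWith (λ ((1≤a , _) , a<3) → 1≤a , ≤-pred a<3)
    (All.filter⁺ (_<? 3) w-letters , All.all-filter (_<? 3) w))
γ-walk (suc t) {k} {suc n} 3+t≤k (s≤s 2+t≤n@(s≤s (s≤s _))) =
  subst (Walk (γ (suc t))) (sym (filter-σ (s≤s z≤n) 3+t≤k (α k n)))
    (raise-walk {x = α k n} (3 + t) (γ-length t) (γ-walk t (≤-trans (n≤1+n _) 3+t≤k) 2+t≤n))

theorem4 : (k : ℕ) → 2 ≤ k → Σ Word λ γ → (n : ℕ) → k ≤ n → PrimitiveGenerator γ (α k n)
theorem4 zero          ()
theorem4 (suc zero)    (s≤s ())
theorem4 k@(suc (suc t)) _ = γ t , λ n k≤n → γ-primitive , γ-generates n k≤n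
  where
  γ-primitive : Primitive (γ t)
  γ-primitive v shorter v⇒γ = <⇒≱ shorter (γ-minimal t (generates⇒walk {v} v⇒γ))
  γ-generates : ∀ n → k ≤ n → Generates (γ t) (α k n)
  γ-generates n k≤n = walk⇒generates (subst (Walk (γ t)) α-unrestricted (γ-walk t ≤-refl k≤n))
    where α-unrestricted = filter-all (_<? suc k) (All.map (s≤s ∘′ proj₂) (α-letters (s≤s z≤n) n))
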